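{- For every integer $n\geq 1$, the number of set partitions $\Pi$ of $[n]$ such that $\mathrm{Flatten}(\Pi)$ avoids the pattern $312$ is the Fibonacci number $F_{2n-1}$.
   Context: A set partition $\Pi$ of $[n]=\{1,\dots,n\}$ is written in standard increasing form: the entries within each block are listed in increasing order, and the blocks are listed in increasing order of their smallest (first) entries. $\mathrm{Flatten}(\Pi)$ is the permutation of $[n]$ (in one-line notation) obtained by concatenating the blocks of $\Pi$ written in this standard increasing form; e.g. $\Pi = 136\text{ - }279\text{ - }4\text{ - }58$ gives $\mathrm{Flatten}(\Pi)=136279458$. A permutation $p=p_1\cdots p_n$ avoids a pattern $\pi=\pi_1\cdots\pi_m$ (a permutation of $[m]$) if there are no indices $i_1<\dots<i_m$ such that $p_{i_1},\dots,p_{i_m}$ are in the same relative order as $\pi_1,\dots,\pi_m$. Fibonacci numbers: $F_0=0$, $F_1=1$, $F_{k}=F_{k-1}+F_{k-2}$. -}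

module Defs where

open import Data.Nat using (ℕ; zero; suc; _+_; _<_)
open import Data.List using (List; []; _∷_; concat; length; lookup; map; upTo)
open import Data.List.Relation.Unary.All using (All)
open import Data.List.Relation.Unary.Linked using (Linked)
open import Data.List.Relation.Binary.Permutation.Propositional using (_↭_)
open import Data.Fin using (Fin) renaming (_<_ to _<ᶠ_)
open import Data.Product using (_×_; ∃-syntax)
open import Data.Empty using (⊥)
open import Data.Unit using (⊤)
open import Relation.Nullary using (¬_)

fib : ℕ → ℕ
fib zero = 0
fib (suc zero) = 1
fib (suc (suc k)) = fib (suc k) + fib k

[_] : ℕ → List ℕ
[ n ] = map suc (upTo n)

NonEmpty : List ℕ → Set
NonEmpty []      = ⊥
NonEmpty (_ ∷ _) = ⊤

FirstLt : List ℕ → List ℕ → Set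
FirstLt (x ∷ _) (y ∷ _) = x < y
FirstLt _       _       = ⊥

-- A set partition of [n] in standard increasing form, represented as the
-- list of its blocks: every block is nonempty, entries within each block are
-- strictly increasing, blocks are listed in increasing order of their first
-- entries, and together the blocks contain each element of [n] exactly once
-- (their concatenation is a permutation of 1,…,n).
IsSetPartition : ℕ → List (List ℕ) → Set
IsSetPartition n Π =
  All NonEmpty Π × All (Linked _<_) Π × Linked FirstLt Π × (concat Π ↭ [ n ])

Flatten : List (List ℕ) → List ℕ
Flatten = concat

Contains312 : List ℕ → Set
Contains312 p = ∃[ i ] ∃[ j ] ∃[ k ]
  (i <ᶠ j × j <ᶠ k × lookup p j < lookup p k × lookup p k < lookup p i)

Avoids312 : List ℕ → Set
Avoids312 p = ¬ Contains312 p

module Submission where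

-- Removing the largest entry n from an admissible partition leaves an
-- admissible partition of [n-1].  Conversely, n may be inserted into an
-- admissible Π either as a new last block {n}, or at the end of a block that
-- is followed by at most one further entry in total: whatever follows n in
-- Flatten must contain no ascent.  Finally it counts: a partition with
-- a trailing singleton block (after some other block) admits three
-- insertions, any other nonempty one two; tracking both kinds gives the
-- recurrences t′ = 2t + s, s′ = t + s solved by t = F_{2n-1}, s = F_{2n-2}.

open import Defs
open import Data.Bool using (Bool; true; false)
open import Data.Empty using (⊥; ⊥-elim)
open import Data.Fin using (Fin; zero; suc; toℕ)
open import Data.List using (List; []; _∷_; _++_; _∷ʳ_; concat; concatMap; filter; length; lookup; map; upTo)
open import Data.List.Membership.Propositional using (_∈_; _∉_; find; lose)
open import Data.List.Membership.Propositional.Properties using (∈-++⁺ˡ; ∈-++⁺ʳ; ∈-++⁻; ∈-map⁺; ∈-map⁻; ∈-upTo⁻; ∈-lookup; ∈-concatMap⁻; ∈-concatMap⁺)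
open import Data.List.Properties using (map-++; upTo-∷ʳ; ++-assoc; ++-identityʳ; ∷-injectiveˡ; ∷-injectiveʳ; filter-all; filter-++; filter-reject; length-++; length-map; map-∘; map-cong-local)
open import Data.List.Relation.Binary.Permutation.Propositional using (_↭_; ↭-refl; ↭-sym; ↭-trans; prep; ↭⇒↭ₛ)
open import Data.List.Relation.Binary.Permutation.Propositional.Properties using (shift; drop-∷; ∷↭∷ʳ; All-resp-↭; ∈-resp-↭; ↭-empty-inv)
open import Data.List.Relation.Binary.Permutation.Setoid.Properties using (Unique-resp-↭)
open import Data.List.Relation.Unary.All using (All; []; _∷_; tabulate)
import Data.List.Relation.Unary.All as All
open import Data.List.Relation.Unary.All.Properties using (++⁻ˡ; ++⁻ʳ)
open import Data.List.Relation.Unary.AllPairs using ([]; _∷_)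
open import Data.List.Relation.Unary.Any using (here; there; index)
open import Data.List.Relation.Unary.Any.Properties using (lookup-index)
open import Data.List.Relation.Unary.Linked using (Linked; []; [-]; _∷_)
import Data.List.Relation.Unary.Linked as Lk
open import Data.List.Relation.Unary.Unique.Propositional using (Unique)
open import Data.List.Relation.Unary.Unique.Propositional.Properties using (map⁺; upTo⁺; ++⁺)
open import Data.Nat using (ℕ; zero; suc; _+_; _≤_; _<_; _*_; _∸_; z≤n; s≤s; _≟_)
open import Data.Nat.ListAction using (sum)
open import Data.Nat.ListAction.Properties using (sum-++)
open import Data.Nat.Properties using (+-identityʳ; *-suc; <-trans; <-asym; <-irrefl; <-≤-trans; ≤∧≢⇒<; suc-injective)
open import Data.Nat.Solver using (module +-*-Solver)
open +-*-Solver using (solve; _:+_; _:*_; _:=_; con)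
open import Data.Product using (_×_; ∃-syntax; _,_; proj₁)
open import Data.Sum using (_⊎_; inj₁; inj₂)
open import Function.Base using (_∘_)
open import Function.Bundles using (_⇔_; mk⇔; Equivalence)
open import Relation.Binary.PropositionalEquality using (_≡_; _≢_; refl; sym; trans; cong; cong₂; subst; setoid; module ≡-Reasoning)
open import Relation.Nullary using (¬_; ¬?)

-- An ascent b < c (b before c) of p whose larger entry c is below x;
-- together with a preceding entry x it forms an occurrence of 312.
data AscentBelow (x : ℕ) : List ℕ → Set where
  start : ∀ {b c p} → c ∈ p → b < c → c < x → AscentBelow x (b ∷ p)
  later : ∀ {b p} → AscentBelow x p → AscentBelow x (b ∷ p)

data Has312 : List ℕ → Set where
  start : ∀ {x p} → AscentBelow x p → Has312 (x ∷ p)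
  later : ∀ {x p} → Has312 p → Has312 (x ∷ p)

ascent-from-positions : ∀ {x} p (j k : Fin (length p)) → toℕ j < toℕ k →
  lookup p j < lookup p k → lookup p k < x → AscentBelow x p
ascent-from-positions (b ∷ p) zero    zero    ()
ascent-from-positions (b ∷ p) zero    (suc k) _ b<c c<x = start (∈-lookup k) b<c c<x
ascent-from-positions (b ∷ p) (suc j) zero    ()
ascent-from-positions (b ∷ p) (suc j) (suc k) (s≤s j<k) b<c c<x =
  later (ascent-from-positions p j k j<k b<c c<x)

contains⇒has312 : ∀ p → Contains312 p → Has312 p
contains⇒has312 (x ∷ p) (zero  , zero  , _     , ()      , _)
contains⇒has312 (x ∷ p) (zero  , suc j , zero  , _       , ()      , _)
contains⇒has312 (x ∷ p) (zero  , suc j , suc k , _       , s≤s j<k , b<c , c<x) =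
  start (ascent-from-positions p j k j<k b<c c<x)
contains⇒has312 (x ∷ p) (suc i , zero  , _     , ()      , _)
contains⇒has312 (x ∷ p) (suc i , suc j , zero  , _       , ()      , _)
contains⇒has312 (x ∷ p) (suc i , suc j , suc k , s≤s i<j , s≤s j<k , b<c , c<x) =
  later (contains⇒has312 p (i , j , k , i<j , j<k , b<c , c<x))

ascent-positions : ∀ {x p} → AscentBelow x p →
  ∃[ j ] ∃[ k ] (toℕ j < toℕ k × lookup p j < lookup p k × lookup p k < x)
ascent-positions {x} {b ∷ p} (start c∈p b<c c<x) =
  zero , suc (index c∈p) , s≤s z≤n ,
  subst (b <_) (lookup-index c∈p) b<c , subst (_< x) (lookup-index c∈p) c<x
ascent-positions (later a) with ascent-positions a
... | j , k , j<k , b<c , c<x = suc j , suc k , s≤s j<k , b<c , c<x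

has312⇒contains : ∀ {p} → Has312 p → Contains312 p
has312⇒contains (start a) with ascent-positions a
... | j , k , j<k , b<c , c<x = zero , suc j , suc k , s≤s z≤n , s≤s j<k , b<c , c<x
has312⇒contains (later h) with has312⇒contains h
... | i , j , k , i<j , j<k , b<c , c<x = suc i , suc j , suc k , s≤s i<j , s≤s j<k , b<c , c<x

ascent-insert : ∀ {x m} u {v} → AscentBelow x (u ++ v) → AscentBelow x (u ++ m ∷ v)
ascent-insert []      a                  = later a
ascent-insert (b ∷ u) (start c∈ b<c c<x) with ∈-++⁻ u c∈
... | inj₁ c∈u = start (∈-++⁺ˡ c∈u) b<c c<x
... | inj₂ c∈v = start (∈-++⁺ʳ u (there c∈v)) b<c c<x
ascent-insert (b ∷ u) (later a)          = later (ascent-insert u a)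

has312-insert : ∀ {m} u {v} → Has312 (u ++ v) → Has312 (u ++ m ∷ v)
has312-insert []      h         = later h
has312-insert (x ∷ u) (start a) = start (ascent-insert u a)
has312-insert (x ∷ u) (later h) = later (has312-insert u h)

has312-++ : ∀ u {p} → Has312 p → Has312 (u ++ p)
has312-++ []      h = h
has312-++ (x ∷ u) h = later (has312-++ u h)

-- Removing an entry m that exceeds everything before it: an ascent below an
-- earlier y < m cannot use m, so it survives the removal.
ascent-remove : ∀ {y m} u {v} → y < m → AscentBelow y (u ++ m ∷ v) → AscentBelow y (u ++ v)
ascent-remove []      y<m (start _ m<c c<y)  = ⊥-elim (<-asym y<m (<-trans m<c c<y))
ascent-remove []      y<m (later a)          = a
ascent-remove (b ∷ u) y<m (start c∈ b<c c<y) with ∈-++⁻ u c∈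
... | inj₁ c∈u         = start (∈-++⁺ˡ c∈u) b<c c<y
... | inj₂ (here refl) = ⊥-elim (<-asym y<m c<y)
... | inj₂ (there c∈v) = start (∈-++⁺ʳ u c∈v) b<c c<y
ascent-remove (b ∷ u) y<m (later a)          = later (ascent-remove u y<m a)

has312-remove : ∀ {m} u {v} → All (_< m) u → Has312 (u ++ m ∷ v) → Has312 (u ++ v) ⊎ AscentBelow m v
has312-remove []      _         (start a) = inj₂ a
has312-remove []      _         (later h) = inj₁ h
has312-remove (y ∷ u) (y<m ∷ _) (start a) = inj₁ (start (ascent-remove u y<m a))
has312-remove (y ∷ u) (_ ∷ u<m) (later h) with has312-remove u u<m h
... | inj₁ h′ = inj₁ (later h′)
... | inj₂ a  = inj₂ a

interval-suc : ∀ n → suc n ∷ [ n ] ↭ [ suc n ]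
interval-suc n = subst (suc n ∷ [ n ] ↭_) snoc (∷↭∷ʳ (suc n) [ n ])
  where
  snoc : [ n ] ∷ʳ suc n ≡ [ suc n ]
  snoc = trans (sym (map-++ suc (upTo n) (n ∷ []))) (cong (map suc) (upTo-∷ʳ n))

interval-≤ : ∀ n → All (_≤ n) [ n ]
interval-≤ n = tabulate λ x∈ → bound (∈-map⁻ suc x∈)
  where
  bound : ∀ {x} → ∃[ y ] (y ∈ upTo n × x ≡ suc y) → x ≤ n
  bound (y , y∈ , refl) = ∈-upTo⁻ y∈

interval-unique : ∀ n → Unique [ n ]
interval-unique n = map⁺ suc-injective (upTo⁺ n)

unique-resp-↭ : ∀ {xs ys : List ℕ} → xs ↭ ys → Unique xs → Unique ys
unique-resp-↭ p = Unique-resp-↭ (setoid ℕ) (↭⇒↭ₛ p)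

Standard : List (List ℕ) → Set
Standard Π = All NonEmpty Π × All (Linked _<_) Π × Linked FirstLt Π

Admissible : ℕ → List (List ℕ) → Set
Admissible n Π = IsSetPartition n Π × Avoids312 (Flatten Π)

isSingleton : List ℕ → Bool
isSingleton (_ ∷ []) = true
isSingleton _        = false

short : List (List ℕ) → Bool
short []          = true
short (C ∷ [])    = isSingleton C
short (_ ∷ _ ∷ _) = false

-- These
-- are exactly the insertions that keep Flatten free of 312 (see below).
data Ins (m : ℕ) : List (List ℕ) → List (List ℕ) → Set where
  newBlock : Ins m [] ((m ∷ []) ∷ [])
  appendTo : ∀ {B Π} → short Π ≡ true → Ins m (B ∷ Π) ((B ∷ʳ m) ∷ Π)
  skip     : ∀ {B Π X} → Ins m Π X → Ins m (B ∷ Π) (B ∷ X)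

keepIf : {A : Set} → Bool → A → List A
keepIf true  a = a ∷ []
keepIf false _ = []

insertions : ℕ → List (List ℕ) → List (List (List ℕ))
insertions m []      = ((m ∷ []) ∷ []) ∷ []
insertions m (B ∷ Π) = keepIf (short Π) ((B ∷ʳ m) ∷ Π) ++ map (B ∷_) (insertions m Π)

insertions⇒Ins : ∀ {m Π X} → X ∈ insertions m Π → Ins m Π X
insertions⇒Ins {Π = []} (here refl) = newBlock
insertions⇒Ins {m} {B ∷ Π} X∈ with short Π in isShort
... | true with X∈
...   | here refl = appendTo isShort
...   | there X∈′ with ∈-map⁻ (B ∷_) X∈′
...     | Y , Y∈ , refl = skip (insertions⇒Ins Y∈)
insertions⇒Ins {m} {B ∷ Π} X∈ | false with ∈-map⁻ (B ∷_) X∈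
...   | Y , Y∈ , refl = skip (insertions⇒Ins Y∈)

Ins⇒insertions : ∀ {m Π X} → Ins m Π X → X ∈ insertions m Π
Ins⇒insertions newBlock = here refl
Ins⇒insertions (appendTo isShort) rewrite isShort = here refl
Ins⇒insertions {m} (skip {B} {Π} i) =
  ∈-++⁺ʳ (keepIf (short Π) ((B ∷ʳ m) ∷ Π)) (∈-map⁺ (B ∷_) (Ins⇒insertions i))

short⇒no-ascent : ∀ {x} Π → short Π ≡ true → ¬ AscentBelow x (concat Π)
short⇒no-ascent ((_ ∷ []) ∷ [])    _  (start () _ _)
short⇒no-ascent ((_ ∷ []) ∷ [])    _  (later ())
short⇒no-ascent ([] ∷ [])          ()
short⇒no-ascent ((_ ∷ _ ∷ _) ∷ []) ()
short⇒no-ascent (_ ∷ _ ∷ _)        ()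

record Split (m : ℕ) (Π X : List (List ℕ)) : Set where
  field
    before after : List ℕ
    flat-X       : concat X ≡ before ++ m ∷ after
    flat-Π       : concat Π ≡ before ++ after
    calm         : ¬ AscentBelow m after

Ins-split : ∀ {m Π X} → Ins m Π X → Split m Π X
Ins-split newBlock = record { before = [] ; after = [] ; flat-X = refl ; flat-Π = refl ; calm = λ () }
Ins-split {m} (appendTo {B} {Π} isShort) = record
  { before = B ; after = concat Π ; flat-X = ++-assoc B (m ∷ []) (concat Π) ; flat-Π = refl
  ; calm = short⇒no-ascent Π isShort }
Ins-split (skip {B} i) = record
  { before = B ++ before ; after = after
  ; flat-X = trans (cong (B ++_) flat-X) (sym (++-assoc B before _))
  ; flat-Π = trans (cong (B ++_) flat-Π) (sym (++-assoc B before after))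
  ; calm = calm }
  where open Split (Ins-split i)

increasing-snoc : ∀ {m} B → Linked _<_ B → All (_< m) B → Linked _<_ (B ∷ʳ m)
increasing-snoc []          _           _          = [-]
increasing-snoc (x ∷ [])    _           (x<m ∷ _)  = x<m ∷ [-]
increasing-snoc (x ∷ y ∷ B) (x<y ∷ inc) (_ ∷ B<m)  = x<y ∷ increasing-snoc (y ∷ B) inc B<m

increasing-unsnoc : ∀ {m} B → Linked _<_ (B ∷ʳ m) → Linked _<_ B
increasing-unsnoc []          _           = []
increasing-unsnoc (x ∷ [])    _           = [-]
increasing-unsnoc (x ∷ y ∷ B) (x<y ∷ inc) = x<y ∷ increasing-unsnoc (y ∷ B) inc

firstLt-snocˡ : ∀ {m} B D → FirstLt B D → FirstLt (B ∷ʳ m) D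
firstLt-snocˡ (_ ∷ _) (_ ∷ _) b<d = b<d

firstLt-snocʳ : ∀ {m} B D → FirstLt B D → FirstLt B (D ∷ʳ m)
firstLt-snocʳ (_ ∷ _) (_ ∷ _) b<d = b<d

firstLt-unsnocˡ : ∀ {m} B D → NonEmpty B → FirstLt (B ∷ʳ m) D → FirstLt B D
firstLt-unsnocˡ (_ ∷ _) (_ ∷ _) _ b<d = b<d

firstLt-unsnocʳ : ∀ {m} B D → NonEmpty D → FirstLt B (D ∷ʳ m) → FirstLt B D
firstLt-unsnocʳ (_ ∷ _) (_ ∷ _) _ b<d = b<d

ordered-snoc : ∀ {m B} Π → Linked FirstLt (B ∷ Π) → Linked FirstLt ((B ∷ʳ m) ∷ Π)
ordered-snoc []      _           = [-]
ordered-snoc (D ∷ _) (b<d ∷ ord) = firstLt-snocˡ _ D b<d ∷ ord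

ordered-unsnoc : ∀ {m B} Π → NonEmpty B → Linked FirstLt ((B ∷ʳ m) ∷ Π) → Linked FirstLt (B ∷ Π)
ordered-unsnoc []      _  _           = [-]
ordered-unsnoc (D ∷ _) ne (b<d ∷ ord) = firstLt-unsnocˡ _ D ne b<d ∷ ord

firstLt-max : ∀ {m} B → NonEmpty B → All (_< m) B → FirstLt B (m ∷ [])
firstLt-max (_ ∷ _) _ (b<m ∷ _) = b<m

insert-nonEmpty : ∀ {m Π X} → Ins m Π X → All NonEmpty Π → All NonEmpty X
insert-nonEmpty newBlock             _         = _ ∷ []
insert-nonEmpty (appendTo {_ ∷ _} _) (_ ∷ ne)  = _ ∷ ne
insert-nonEmpty (skip i)             (nB ∷ ne) = nB ∷ insert-nonEmpty i ne

insert-increasing : ∀ {m Π X} → Ins m Π X → All (_< m) (concat Π) → All (Linked _<_) Π → All (Linked _<_) X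
insert-increasing newBlock         _   _            = [-] ∷ []
insert-increasing (appendTo {B} _) bnd (inc ∷ incs) = increasing-snoc B inc (++⁻ˡ B bnd) ∷ incs
insert-increasing (skip {B} i)     bnd (inc ∷ incs) = inc ∷ insert-increasing i (++⁻ʳ B bnd) incs

insert-ordered-after : ∀ {m Π X A} → Ins m Π X → All NonEmpty Π → All (_< m) (concat Π) →
  FirstLt A (m ∷ []) → Linked FirstLt (A ∷ Π) → Linked FirstLt (A ∷ X)
insert-ordered-after newBlock _ _ a<m _ = a<m ∷ [-]
insert-ordered-after {A = A} (appendTo {B} {Π} _) _ _ _ (a<b ∷ ord) =
  firstLt-snocʳ A B a<b ∷ ordered-snoc Π ord
insert-ordered-after (skip {B} i) (nB ∷ ne) bnd _ (a<b ∷ ord) =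
  a<b ∷ insert-ordered-after i ne (++⁻ʳ B bnd) (firstLt-max B nB (++⁻ˡ B bnd)) ord

insert-ordered : ∀ {m Π X} → Ins m Π X → All NonEmpty Π → All (_< m) (concat Π) →
  Linked FirstLt Π → Linked FirstLt X
insert-ordered newBlock             _         _   _   = [-]
insert-ordered (appendTo {B} {Π} _) _         _   ord = ordered-snoc Π ord
insert-ordered (skip {B} i)         (nB ∷ ne) bnd ord =
  insert-ordered-after i ne (++⁻ʳ B bnd) (firstLt-max B nB (++⁻ˡ B bnd)) ord

insert-standard : ∀ {m Π X} → Ins m Π X → All (_< m) (concat Π) → Standard Π → Standard X
insert-standard i bnd (ne , incs , ord) =
  insert-nonEmpty i ne , insert-increasing i bnd incs , insert-ordered i ne bnd ord

standard-partition : ∀ {n Π} → Standard Π → concat Π ↭ [ n ] → IsSetPartition n Π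
standard-partition (ne , incs , ord) perm = ne , incs , ord , perm

partition-≤ : ∀ {n} Π → concat Π ↭ [ n ] → All (_≤ n) (concat Π)
partition-≤ {n} _ perm = All-resp-↭ (↭-sym perm) (interval-≤ n)

-- A 312 of the result either avoids n+1,
-- and then already occurs in Π, or uses n+1 as its "3" and needs an ascent
-- after n+1, which the calm tail does not have.
insert-admissible : ∀ {n Π X} → Admissible n Π → Ins (suc n) Π X → Admissible (suc n) X
insert-admissible {n} {Π} {X} ((ne , incs , ord , perm) , avoids) i =
  standard-partition (insert-standard i bnd (ne , incs , ord)) perm′ , avoids′
  where
  open Split (Ins-split i)
  bnd : All (_< suc n) (concat Π)
  bnd = All.map s≤s (partition-≤ Π perm)
  perm′ : concat X ↭ [ suc n ]
  perm′ = subst (_↭ [ suc n ]) (sym flat-X)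
    (↭-trans (shift (suc n) before after)
    (↭-trans (prep (suc n) (subst (_↭ [ n ]) flat-Π perm)) (interval-suc n)))
  avoids′ : Avoids312 (Flatten X)
  avoids′ c with has312-remove before (++⁻ˡ before (subst (All (_< suc n)) flat-Π bnd))
                   (subst Has312 flat-X (contains⇒has312 _ c))
  ... | inj₁ h = avoids (has312⇒contains (subst Has312 (sym flat-Π) h))
  ... | inj₂ a = calm a

max-is-last : ∀ {m} B → Linked _<_ B → All (_≤ m) B → m ∈ B → ∃[ B₀ ] (B ≡ B₀ ∷ʳ m)
max-is-last (x ∷ [])    _         _             (here refl) = [] , refl
max-is-last (x ∷ y ∷ B) (x<y ∷ _) (_ ∷ y≤x ∷ _) (here refl) = ⊥-elim (<-irrefl refl (<-≤-trans x<y y≤x))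
max-is-last (x ∷ y ∷ B) (_ ∷ inc) (_ ∷ B≤m)     (there m∈)  with max-is-last (y ∷ B) inc B≤m m∈
... | B₀ , B≡ = x ∷ B₀ , cong (x ∷_) B≡

unique-++ʳ : ∀ (B : List ℕ) {ys} → Unique (B ++ ys) → Unique ys
unique-++ʳ []      u       = u
unique-++ʳ (x ∷ B) (_ ∷ u) = unique-++ʳ B u

unique-++-disjoint : ∀ (B : List ℕ) {ys a} → Unique (B ++ ys) → a ∈ B → a ∉ ys
unique-++-disjoint (x ∷ B) (x∉ ∷ _) (here refl) a∈ys = All.lookup x∉ (∈-++⁺ʳ B a∈ys) refl
unique-++-disjoint (x ∷ B) (_ ∷ u)  (there a∈)  a∈ys = unique-++-disjoint B u a∈ a∈ys

below-if-not-max : ∀ {m} {xs : List ℕ} → All (_≤ m) xs → m ∉ xs → All (_< m) xs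
below-if-not-max []          _  = []
below-if-not-max (x≤m ∷ xs≤) m∉ =
  ≤∧≢⇒< x≤m (λ x≡m → m∉ (here (sym x≡m))) ∷ below-if-not-max xs≤ (λ m∈ → m∉ (there m∈))

-- Blocks in standard form below m whose flattening has no ascent below m are
-- short: two entries in one block, or the first entries of two blocks, would
-- form such an ascent.
calm⇒short : ∀ {m} Π → Standard Π → All (_< m) (concat Π) → ¬ AscentBelow m (concat Π) → short Π ≡ true
calm⇒short []                      _                        _              _    = refl
calm⇒short ((_ ∷ []) ∷ [])         _                        _              _    = refl
calm⇒short ([] ∷ [])               (() ∷ _ , _)             _              _
calm⇒short ((c ∷ c′ ∷ C) ∷ [])     (_ , (c<c′ ∷ _) ∷ _ , _) (_ ∷ c′<m ∷ _) calm =
  ⊥-elim (calm (start (here refl) c<c′ c′<m))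
calm⇒short ((c ∷ C) ∷ (d ∷ D) ∷ _) (_ , _ , c<d ∷ _)        bnd            calm =
  ⊥-elim (calm (start d∈ c<d (All.lookup bnd (there d∈))))
  where
  d∈ : d ∈ C ++ (d ∷ D) ++ _
  d∈ = ∈-++⁺ʳ C (here refl)

remove-from-block : ∀ {m} B₀ X → Standard ((B₀ ∷ʳ m) ∷ X) → All (_< m) (concat X) →
  ¬ AscentBelow m (concat X) → ∃[ Π ] (Ins m Π ((B₀ ∷ʳ m) ∷ X) × Standard Π)
remove-from-block []      []            _                 _         _ = [] , newBlock , [] , [] , []
remove-from-block []      ((d ∷ _) ∷ _) (_ , _ , m<d ∷ _) (d<m ∷ _) _ = ⊥-elim (<-asym m<d d<m)
remove-from-block (b ∷ B) X (_ ∷ ne , inc ∷ incs , ord) bnd calm =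
  (b ∷ B) ∷ X , appendTo (calm⇒short X (ne , incs , Lk.tail ord) bnd calm) ,
  (_ ∷ ne , increasing-unsnoc (b ∷ B) inc ∷ incs , ordered-unsnoc X _ ord)

remove-ordered : ∀ {m Π X} B → Ins m Π X → All NonEmpty Π → Linked FirstLt (B ∷ X) →
  Linked FirstLt Π → Linked FirstLt (B ∷ Π)
remove-ordered B newBlock         _        _         _   = [-]
remove-ordered B (appendTo {D} _) (nD ∷ _) (b<d ∷ _) ord = firstLt-unsnocʳ B D nD b<d ∷ ord
remove-ordered B (skip i)         _        (b<d ∷ _) ord = b<d ∷ ord

remove-max : ∀ {m} X → Standard X → All (_≤ m) (concat X) → Unique (concat X) → m ∈ concat X →
  ¬ Has312 (concat X) → ∃[ Π ] (Ins m Π X × Standard Π)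
remove-max {m} (B ∷ X) (nB ∷ ne , inc ∷ incs , ord) bnd u m∈ no312 with ∈-++⁻ B m∈
... | inj₂ m∈X with remove-max X (ne , incs , Lk.tail ord) (++⁻ʳ B bnd) (unique-++ʳ B u) m∈X
                       (λ h → no312 (has312-++ B h))
...   | Π , i , ne′ , incs′ , ord′ =
  B ∷ Π , skip i , nB ∷ ne′ , inc ∷ incs′ , remove-ordered B i ne′ ord ord′
remove-max {m} (B ∷ X) std@(_ , inc ∷ _ , _) bnd u m∈ no312 | inj₁ m∈B
  with max-is-last B inc (++⁻ˡ B bnd) m∈B
... | B₀ , refl = remove-from-block B₀ X std
  (below-if-not-max (++⁻ʳ B bnd) (unique-++-disjoint B u m∈B))
  (λ a → no312 (subst Has312 (sym (++-assoc B₀ (m ∷ []) (concat X))) (has312-++ B₀ (start a))))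

remove-admissible : ∀ {n X} → Admissible (suc n) X → ∃[ Π ] (Ins (suc n) Π X × Admissible n Π)
remove-admissible {n} {X} ((ne , incs , ord , perm) , avoids)
  with remove-max X (ne , incs , ord) (partition-≤ X perm)
         (unique-resp-↭ (↭-sym perm) (interval-unique (suc n)))
         (∈-resp-↭ (↭-trans (interval-suc n) (↭-sym perm)) (here refl))
         (λ h → avoids (has312⇒contains h))
... | Π , i , std = Π , i , standard-partition std perm′ , avoids′
  where
  open Split (Ins-split i)
  perm′ : concat Π ↭ [ n ]
  perm′ = subst (_↭ [ n ]) (sym flat-Π) (drop-∷
    (↭-trans (↭-sym (shift (suc n) before after))
    (↭-trans (subst (_↭ [ suc n ]) flat-X perm) (↭-sym (interval-suc n)))))
  avoids′ : Avoids312 (Flatten Π)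
  avoids′ c = avoids (has312⇒contains (subst Has312 (sym flat-X)
    (has312-insert before (subst Has312 flat-Π (contains⇒has312 _ c)))))

strip : ℕ → List ℕ → List ℕ
strip m = filter (λ x → ¬? (x ≟ m))

strip-absent : ∀ {m} B → m ∉ B → strip m B ≡ B
strip-absent {m} B m∉ = filter-all (λ x → ¬? (x ≟ m)) (tabulate λ x∈ x≡m → m∉ (subst (_∈ B) x≡m x∈))

strip-snoc : ∀ {m} B → m ∉ B → strip m (B ∷ʳ m) ≡ B
strip-snoc {m} B m∉ = begin
  strip m (B ++ m ∷ [])          ≡⟨ filter-++ (λ x → ¬? (x ≟ m)) B (m ∷ []) ⟩
  strip m B ++ strip m (m ∷ [])  ≡⟨ cong₂ _++_ (strip-absent B m∉)
                                           (filter-reject (λ x → ¬? (x ≟ m)) (λ m≢m → m≢m refl)) ⟩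
  B ++ []                        ≡⟨ ++-identityʳ B ⟩
  B                              ∎
  where open ≡-Reasoning

consNonEmpty : List ℕ → List (List ℕ) → List (List ℕ)
consNonEmpty []      Π = Π
consNonEmpty (b ∷ B) Π = (b ∷ B) ∷ Π

delete : ℕ → List (List ℕ) → List (List ℕ)
delete m []      = []
delete m (B ∷ X) = consNonEmpty (strip m B) (delete m X)

Fresh : ℕ → List (List ℕ) → Set
Fresh m Π = All NonEmpty Π × m ∉ concat Π

fresh-head : ∀ {m B Π} → Fresh m (B ∷ Π) → m ∉ B
fresh-head (_ , m∉) m∈ = m∉ (∈-++⁺ˡ m∈)

fresh-tail : ∀ {m B Π} → Fresh m (B ∷ Π) → Fresh m Π
fresh-tail {B = B} (_ ∷ ne , m∉) = ne , λ m∈ → m∉ (∈-++⁺ʳ B m∈)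

consNonEmpty-nonEmpty : ∀ B Π → NonEmpty B → consNonEmpty B Π ≡ B ∷ Π
consNonEmpty-nonEmpty (_ ∷ _) Π _ = refl

delete-absent : ∀ {m} Π → Fresh m Π → delete m Π ≡ Π
delete-absent []      _                       = refl
delete-absent (B ∷ Π) fresh@(nB ∷ _ , _)
  rewrite strip-absent B (fresh-head fresh) | delete-absent Π (fresh-tail fresh) =
  consNonEmpty-nonEmpty B Π nB

delete-insert : ∀ {m Π X} → Ins m Π X → Fresh m Π → delete m X ≡ Π
delete-insert {m} newBlock _ rewrite strip-snoc {m} [] (λ ()) = refl
delete-insert (appendTo {B} {Π} _) fresh@(nB ∷ _ , _)
  rewrite strip-snoc B (fresh-head fresh) | delete-absent Π (fresh-tail fresh) =
  consNonEmpty-nonEmpty B Π nB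
delete-insert (skip {B} {Π} i) fresh@(nB ∷ _ , _)
  rewrite strip-absent B (fresh-head fresh) | delete-insert i (fresh-tail fresh) =
  consNonEmpty-nonEmpty B Π nB

insertions-injective : ∀ {m Π Π′ X} → X ∈ insertions m Π → X ∈ insertions m Π′ →
  Fresh m Π → Fresh m Π′ → Π ≡ Π′
insertions-injective X∈ X∈′ fresh fresh′ =
  trans (sym (delete-insert (insertions⇒Ins X∈) fresh)) (delete-insert (insertions⇒Ins X∈′) fresh′)

snoc-≢ : ∀ {m} (B : List ℕ) → B ∷ʳ m ≢ B
snoc-≢ []      ()
snoc-≢ (b ∷ B) e = snoc-≢ B (∷-injectiveʳ e)

insertions-unique : ∀ m Π → Unique (insertions m Π)
insertions-unique m []      = [] ∷ []
insertions-unique m (B ∷ Π) with short Π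
... | true  = tabulate (λ Y∈ e → first-blocks-differ (subst (_∈ _) (sym e) Y∈)) ∷ rest
  where
  first-blocks-differ : (B ∷ʳ m) ∷ Π ∉ map (B ∷_) (insertions m Π)
  first-blocks-differ X∈ with ∈-map⁻ (B ∷_) X∈
  ... | _ , _ , e = snoc-≢ B (∷-injectiveˡ e)
  rest : Unique (map (B ∷_) (insertions m Π))
  rest = map⁺ ∷-injectiveʳ (insertions-unique m Π)
... | false = map⁺ ∷-injectiveʳ (insertions-unique m Π)

concatMap-insertions-unique : ∀ m L → Unique L → All (Fresh m) L → Unique (concatMap (insertions m) L)
concatMap-insertions-unique m []      []        []               = []
concatMap-insertions-unique m (Π ∷ L) (Π∉ ∷ uL) (fresh ∷ freshL) =
  ++⁺ (insertions-unique m Π) (concatMap-insertions-unique m L uL freshL) disjoint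
  where
  disjoint : ∀ {X} → ¬ (X ∈ insertions m Π × X ∈ concatMap (insertions m) L)
  disjoint (X∈ , X∈L) with find (∈-concatMap⁻ (insertions m) {xs = L} X∈L)
  ... | Π′ , Π′∈ , X∈′ = All.lookup Π∉ Π′∈ (insertions-injective X∈ X∈′ fresh (All.lookup freshL Π′∈))

admissibles : ℕ → List (List (List ℕ))
admissibles zero    = [] ∷ []
admissibles (suc n) = concatMap (insertions (suc n)) (admissibles n)

admissible-zero-empty : ∀ Π → Admissible zero Π → Π ≡ []
admissible-zero-empty []            _                        = refl
admissible-zero-empty ([] ∷ _)      ((() ∷ _ , _) , _)
admissible-zero-empty ((_ ∷ _) ∷ _) ((_ , _ , _ , perm) , _) with () ← ↭-empty-inv perm

admissible-zero : ∀ Π → Π ∈ admissibles zero ⇔ Admissible zero Π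
admissible-zero Π = mk⇔ to (λ adm → subst (_∈ _) (sym (admissible-zero-empty Π adm)) (here refl))
  where
  to : Π ∈ admissibles zero → Admissible zero Π
  to (here refl) = ([] , [] , [] , ↭-refl) , λ ()

∈-admissibles : ∀ n Π → Π ∈ admissibles n ⇔ Admissible n Π
∈-admissibles zero    Π = admissible-zero Π
∈-admissibles (suc n) X = mk⇔ to from
  where
  to : X ∈ admissibles (suc n) → Admissible (suc n) X
  to X∈ with find (∈-concatMap⁻ (insertions (suc n)) {xs = admissibles n} X∈)
  ... | Π , Π∈ , X∈′ = insert-admissible (Equivalence.to (∈-admissibles n Π) Π∈) (insertions⇒Ins X∈′)
  from : Admissible (suc n) X → X ∈ admissibles (suc n)
  from adm with remove-admissible adm
  ... | Π , i , adm′ = ∈-concatMap⁺ (insertions (suc n))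
    (lose (Equivalence.from (∈-admissibles n Π) adm′) (Ins⇒insertions i))

admissible-fresh : ∀ {n Π} → Admissible n Π → Fresh (suc n) Π
admissible-fresh {n} {Π} ((ne , _ , _ , perm) , _) =
  ne , λ n+1∈ → <-irrefl refl (All.lookup (partition-≤ Π perm) n+1∈)

admissibles-unique : ∀ n → Unique (admissibles n)
admissibles-unique zero    = [] ∷ []
admissibles-unique (suc n) = concatMap-insertions-unique (suc n) (admissibles n) (admissibles-unique n)
  (tabulate λ {Π} Π∈ → admissible-fresh (Equivalence.to (∈-admissibles n Π) Π∈))

-- Besides the number of admissible partitions we track how many
-- of them have at least two blocks and a singleton last block: exactly
-- these allow the extra insertion into the second-to-last block.
indicator : Bool → ℕ
indicator true  = 1
indicator false = 0

tally : {A : Set} → (A → Bool) → List A → ℕ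
tally p xs = sum (map (indicator ∘ p) xs)

tally-++ : ∀ {A : Set} (p : A → Bool) xs ys → tally p (xs ++ ys) ≡ tally p xs + tally p ys
tally-++ p xs ys = trans (cong sum (map-++ (indicator ∘ p) xs ys)) (sum-++ (map (indicator ∘ p) xs) _)

tally-map : ∀ {A B : Set} (p : B → Bool) (f : A → B) xs → tally p (map f xs) ≡ tally (p ∘ f) xs
tally-map p f xs = cong sum (sym (map-∘ xs))

tally-cong : ∀ {A : Set} {p q : A → Bool} xs → (∀ {x} → x ∈ xs → p x ≡ q x) → tally p xs ≡ tally q xs
tally-cong xs p≡q = cong sum (map-cong-local (tabulate λ x∈ → cong indicator (p≡q x∈)))

endsInSingleton : List (List ℕ) → Bool
endsInSingleton []          = false
endsInSingleton (C ∷ [])    = isSingleton C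
endsInSingleton (_ ∷ D ∷ Π) = endsInSingleton (D ∷ Π)

trailingSingleton : List (List ℕ) → Bool
trailingSingleton []      = false
trailingSingleton (_ ∷ Π) = endsInSingleton Π

short-split : ∀ C Π →
  indicator (short (C ∷ Π)) + indicator (trailingSingleton (C ∷ Π)) ≡ indicator (endsInSingleton (C ∷ Π))
short-split C []      = +-identityʳ _
short-split C (_ ∷ _) = refl

length-keepIf : ∀ {A : Set} b (a : A) → length (keepIf b a) ≡ indicator b
length-keepIf true  _ = refl
length-keepIf false _ = refl

insertions-length : ∀ m B Π → length (insertions m (B ∷ Π)) ≡ 2 + indicator (trailingSingleton (B ∷ Π))
insertions-length m B []      = refl
insertions-length m B (C ∷ Π) = begin
  length (keepIf s ((B ∷ʳ m) ∷ C ∷ Π) ++ map (B ∷_) (insertions m (C ∷ Π)))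
    ≡⟨ length-++ (keepIf s _) ⟩
  length (keepIf s _) + length (map (B ∷_) (insertions m (C ∷ Π)))
    ≡⟨ cong₂ _+_ (length-keepIf s _)
         (trans (length-map (B ∷_) (insertions m (C ∷ Π))) (insertions-length m C Π)) ⟩
  indicator s + (2 + indicator (trailingSingleton (C ∷ Π)))
    ≡⟨ solve 2 (λ a t → a :+ (con 2 :+ t) := con 2 :+ (a :+ t)) refl (indicator s) _ ⟩
  2 + (indicator s + indicator (trailingSingleton (C ∷ Π)))
    ≡⟨ cong (2 +_) (short-split C Π) ⟩
  2 + indicator (endsInSingleton (C ∷ Π)) ∎
  where
  open ≡-Reasoning
  s : Bool
  s = short (C ∷ Π)

isSingleton-snoc : ∀ {m} B → NonEmpty B → isSingleton (B ∷ʳ m) ≡ false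
isSingleton-snoc (_ ∷ [])    _ = refl
isSingleton-snoc (_ ∷ _ ∷ _) _ = refl

-- Results of insertions are never empty, so prepending a block does not
-- change whether they end in a singleton.
insert-endsInSingleton : ∀ {m Π X} B → Ins m Π X → endsInSingleton (B ∷ X) ≡ endsInSingleton X
insert-endsInSingleton B newBlock     = refl
insert-endsInSingleton B (appendTo _) = refl
insert-endsInSingleton B (skip _)     = refl

appended-ends : ∀ {m} B Π → NonEmpty B →
  tally endsInSingleton (keepIf (short Π) ((B ∷ʳ m) ∷ Π)) + (1 + indicator (trailingSingleton Π))
    ≡ 1 + indicator (endsInSingleton Π)
appended-ends {m} B []                 nB rewrite isSingleton-snoc {m} B nB = refl
appended-ends B ([] ∷ [])          _ = refl
appended-ends B ((_ ∷ []) ∷ [])    _ = refl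
appended-ends B ((_ ∷ _ ∷ _) ∷ []) _ = refl
appended-ends B (_ ∷ _ ∷ _)        _ = refl

appended-trailing : ∀ {m} B Π →
  tally trailingSingleton (keepIf (short Π) ((B ∷ʳ m) ∷ Π)) + (1 + indicator (trailingSingleton Π))
    ≡ 1 + indicator (endsInSingleton Π)
appended-trailing B []                 = refl
appended-trailing B ([] ∷ [])          = refl
appended-trailing B ((_ ∷ []) ∷ [])    = refl
appended-trailing B ((_ ∷ _ ∷ _) ∷ []) = refl
appended-trailing B (_ ∷ _ ∷ _)        = refl

insertions-ends : ∀ m Π → All NonEmpty Π →
  tally endsInSingleton (insertions m Π) ≡ 1 + indicator (trailingSingleton Π)
insertions-ends m []      _         = refl
insertions-ends m (B ∷ Π) (nB ∷ ne) = begin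
  tally endsInSingleton (appended ++ map (B ∷_) (insertions m Π))
    ≡⟨ tally-++ endsInSingleton appended _ ⟩
  tally endsInSingleton appended + tally endsInSingleton (map (B ∷_) (insertions m Π))
    ≡⟨ cong (tally endsInSingleton appended +_) skipped ⟩
  tally endsInSingleton appended + (1 + indicator (trailingSingleton Π))
    ≡⟨ appended-ends B Π nB ⟩
  1 + indicator (endsInSingleton Π) ∎
  where
  open ≡-Reasoning
  appended : List (List (List ℕ))
  appended = keepIf (short Π) ((B ∷ʳ m) ∷ Π)
  skipped : tally endsInSingleton (map (B ∷_) (insertions m Π)) ≡ 1 + indicator (trailingSingleton Π)
  skipped = trans (tally-map endsInSingleton (B ∷_) (insertions m Π))
    (trans (tally-cong (insertions m Π) (λ X∈ → insert-endsInSingleton B (insertions⇒Ins {m} {Π} X∈)))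
    (insertions-ends m Π ne))

insertions-trailing : ∀ m B Π → All NonEmpty Π →
  tally trailingSingleton (insertions m (B ∷ Π)) ≡ 1 + indicator (trailingSingleton (B ∷ Π))
insertions-trailing m B Π ne = begin
  tally trailingSingleton (appended ++ map (B ∷_) (insertions m Π))
    ≡⟨ tally-++ trailingSingleton appended _ ⟩
  tally trailingSingleton appended + tally trailingSingleton (map (B ∷_) (insertions m Π))
    ≡⟨ cong (tally trailingSingleton appended +_)
         (trans (tally-map trailingSingleton (B ∷_) (insertions m Π)) (insertions-ends m Π ne)) ⟩
  tally trailingSingleton appended + (1 + indicator (trailingSingleton Π))
    ≡⟨ appended-trailing B Π ⟩
  1 + indicator (endsInSingleton Π) ∎
  where
  open ≡-Reasoning
  appended : List (List (List ℕ))
  appended = keepIf (short Π) ((B ∷ʳ m) ∷ Π)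

Inhabited : List (List ℕ) → Set
Inhabited []      = ⊥
Inhabited (B ∷ Π) = All NonEmpty (B ∷ Π)

admissible-inhabited : ∀ {k} Π → Admissible (suc k) Π → Inhabited Π
admissible-inhabited []      ((_ , _ , _ , perm) , _) with () ← ↭-empty-inv (↭-sym perm)
admissible-inhabited (_ ∷ _) ((ne , _) , _)            = ne

length-after-insertion : ∀ m L → All Inhabited L →
  length (concatMap (insertions m) L) ≡ 2 * length L + tally trailingSingleton L
length-after-insertion m []            []        = refl
length-after-insertion m ((B ∷ Π) ∷ L) (_ ∷ inh) =
  trans (length-++ (insertions m (B ∷ Π)))
  (trans (cong₂ _+_ (insertions-length m B Π) (length-after-insertion m L inh))
  (solve 3 (λ s t u → (con 2 :+ s) :+ (con 2 :* t :+ u) := con 2 :* (con 1 :+ t) :+ (s :+ u)) refl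
     (indicator (trailingSingleton (B ∷ Π))) (length L) (tally trailingSingleton L)))

trailing-after-insertion : ∀ m L → All Inhabited L →
  tally trailingSingleton (concatMap (insertions m) L) ≡ length L + tally trailingSingleton L
trailing-after-insertion m []            []               = refl
trailing-after-insertion m ((B ∷ Π) ∷ L) ((_ ∷ ne) ∷ inh) =
  trans (tally-++ trailingSingleton (insertions m (B ∷ Π)) _)
  (trans (cong₂ _+_ (insertions-trailing m B Π ne) (trailing-after-insertion m L inh))
  (solve 3 (λ s t u → (con 1 :+ s) :+ (t :+ u) := (con 1 :+ t) :+ (s :+ u)) refl
     (indicator (trailingSingleton (B ∷ Π))) (length L) (tally trailingSingleton L)))

-- The recurrences t′ = 2t + s, s′ = t + s are those of (F_{2k+1}, F_{2k}).
fib-even : ∀ k → fib (2 * suc k) ≡ fib (suc (2 * k)) + fib (2 * k)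
fib-even k = cong fib (*-suc 2 k)

fib-odd : ∀ k → fib (suc (2 * suc k)) ≡ 2 * fib (suc (2 * k)) + fib (2 * k)
fib-odd k = trans (cong (fib ∘ suc) (*-suc 2 k))
  (solve 2 (λ a b → (a :+ b) :+ a := con 2 :* a :+ b) refl (fib (suc (2 * k))) (fib (2 * k)))

admissibles-count : ∀ k → length (admissibles (suc k)) ≡ fib (suc (2 * k))
                        × tally trailingSingleton (admissibles (suc k)) ≡ fib (2 * k)
admissibles-count zero    = refl , refl
admissibles-count (suc k) with admissibles-count k
... | t≡ , s≡ =
  trans (length-after-insertion (2 + k) L inh) (trans (cong₂ (λ t s → 2 * t + s) t≡ s≡) (sym (fib-odd k))) ,
  trans (trailing-after-insertion (2 + k) L inh) (trans (cong₂ _+_ t≡ s≡) (sym (fib-even k)))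
  where
  L : List (List (List ℕ))
  L = admissibles (suc k)
  inh : All Inhabited L
  inh = tabulate λ {Π} Π∈ → admissible-inhabited Π (Equivalence.to (∈-admissibles (suc k) Π) Π∈)

mainTheorem5 : (n : ℕ) → 1 ≤ n →
    ∃[ ps ] (Unique ps ×
      (∀ (Π : List (List ℕ)) → (Π ∈ ps) ⇔ (IsSetPartition n Π × Avoids312 (Flatten Π))) ×
      length ps ≡ fib (2 * n ∸ 1))
mainTheorem5 (suc k) _ =
  admissibles (suc k) , admissibles-unique (suc k) , ∈-admissibles (suc k) ,
  trans (proj₁ (admissibles-count k)) (cong (λ x → fib (x ∸ 1)) (sym (*-suc 2 k)))
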